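{- Let $m,n\geq 3$. If either $m\not\equiv 0 \pmod 4$ and $n\neq 4$, or $n\not\equiv 0\pmod 4$ and $m\neq 4$, then the direct product $C_m\times C_n$ is not distance magic.
   Context: $C_n$ denotes the cycle on $n$ vertices. The direct product $G\times H$ has vertex set $V(G)\times V(H)$, with $(g,h)$ adjacent to $(g',h')$ iff $gg'\in E(G)$ and $hh'\in E(H)$. A graph $X$ of order $N$ is distance magic if there is a bijection $\ell\colon V(X)\to\{1,\ldots,N\}$ and a positive integer $k$ such that $\sum_{y\in N(x)}\ell(y)=k$ for every vertex $x$, where $N(x)$ is the open neighborhood of $x$. -}

module Defs where

open import Data.Nat using (ℕ; zero; suc; _+_; _*_; _<_; _≟_; NonZero)
open import Data.Nat.DivMod using (_%_)
open import Data.Fin using (Fin; toℕ)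
open import Data.Product using (_×_; _,_; ∃; Σ)
open import Data.Sum using (_⊎_)
open import Data.Bool using (Bool; if_then_else_; _∨_; _∧_)
open import Data.List using (List; map; allFin; concatMap)
open import Data.Nat.ListAction using (sum)
open import Relation.Nullary.Decidable using (⌊_⌋)
open import Relation.Binary.PropositionalEquality using (_≡_)
open import Function.Bundles using (_⤖_; Bijection)

cycleAdj : (m : ℕ) .{{_ : NonZero m}} → Fin m → Fin m → Bool
cycleAdj m i j = ⌊ toℕ j ≟ (suc (toℕ i)) % m ⌋ ∨ ⌊ toℕ i ≟ (suc (toℕ j)) % m ⌋

prodAdj : (m n : ℕ) .{{_ : NonZero m}} .{{_ : NonZero n}} →
          Fin m × Fin n → Fin m × Fin n → Bool
prodAdj m n (g , h) (g' , h') = cycleAdj m g g' ∧ cycleAdj n h h'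

vertices : (m n : ℕ) → List (Fin m × Fin n)
vertices m n = concatMap (λ i → map (λ j → (i , j)) (allFin n)) (allFin m)

nbhdSum : (m n : ℕ) .{{_ : NonZero m}} .{{_ : NonZero n}} →
          (Fin m × Fin n → ℕ) → Fin m × Fin n → ℕ
nbhdSum m n ℓ x =
  sum (map (λ y → if prodAdj m n x y then ℓ y else 0) (vertices m n))

-- C_m × C_n is distance magic: a bijection ℓ : V → {1,…,mn}
-- (encoded as a bijection onto Fin (m*n), label = toℕ + 1) and k > 0
-- with constant neighbourhood sums k.
DistanceMagicCmCn : (m n : ℕ) .{{_ : NonZero m}} .{{_ : NonZero n}} → Set
DistanceMagicCmCn m n =
  Σ ((Fin m × Fin n) ⤖ Fin (m * n)) λ ℓ →
  Σ ℕ λ k → (0 < k) ×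
    (∀ x → nbhdSum m n (λ y → suc (toℕ (Bijection.to ℓ y))) x ≡ k)

module Submission where

-- Write F a b (labelAt) for the label of the vertex (a mod m, b mod n),
-- a function ℕ → ℕ → ℕ that is m-periodic in a and n-periodic in b.  For m, n ≥ 3
-- the four neighbours of (a+1, b+1) in C_m × C_n are (a, b), (a, b+2), (a+2, b)
-- and (a+2, b+2), so distance magic with constant k says that the square sum
-- square F a b = H a b + H (a+2) b equals k, where H a b = F a b + F a (b+2).
-- If 4 ∤ m, the function a ↦ H a b (for fixed b) alternates around k with step 2,
-- hence has period 4; it also has period m, and since 2 is congruent to a multiple of m
-- modulo 4 it has period 2.  Thus 2 H a b = k for all a, b, so H 0 0 = H 0 2, which gives
-- F 0 0 = F 0 4: the vertices (0,0) and (0,4) get the same label.  As labels are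
-- injective, 0 ≡ 4 (mod n), impossible for n ≥ 3, n ≠ 4.  The other case follows
-- by exchanging the roles of the two factors.

open import Defs
open import Data.Nat using (ℕ; zero; suc; _+_; _*_; _≤_; _<_; _%_; pred; NonZero; _≟_; s≤s)
open import Data.Nat.Properties
  using (+-comm; +-assoc; +-suc; +-identityʳ; +-cancelˡ-≡; +-cancelʳ-≡; *-cancelˡ-≡;
         suc-pred; +-commutativeSemigroup) renaming (suc-injective to suc-injectiveℕ)
open import Data.Nat.DivMod using (_mod_; m<n⇒m%n≡m; m%n<n; m%n%n≡m%n; [m+n]%n≡m%n; %-distribˡ-+; %-remove-+ˡ; m≡m%n+[m/n]*n; _/_)
open import Data.Nat.Divisibility using (∣-refl)
open import Data.Nat.Tactic.RingSolver using (solve-∀)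
open import Algebra.Properties.CommutativeSemigroup +-commutativeSemigroup using (interchange)
open import Data.Fin using (Fin; toℕ) renaming (zero to fzero; suc to fsuc)
open import Data.Fin.Properties using (toℕ-injective; toℕ-fromℕ<; toℕ<n; suc-injective)
open import Data.Product using (_×_; _,_; proj₁; proj₂; ∃₂)
open import Data.Sum using (_⊎_; inj₁; inj₂)
open import Data.Bool using (Bool; true; false; if_then_else_; _∨_; _∧_)
open import Data.Bool.Properties using (∨-zeroʳ)
open import Data.List using (List; []; _∷_; map; allFin; tabulate; concatMap; _++_)
open import Data.List.Properties using (map-++; map-cong; map-∘; map-tabulate)
open import Data.Nat.ListAction using (sum)
open import Data.Nat.ListAction.Properties using (sum-++)
open import Data.Empty using (⊥-elim)
open import Relation.Nullary using (¬_; Dec)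
open import Relation.Nullary.Decidable using (⌊_⌋; isYes≗does; dec-true; dec-false)
open import Relation.Binary.PropositionalEquality
  using (_≡_; _≢_; refl; sym; trans; cong; cong₂; module ≡-Reasoning)
open import Function using (_∘_; id; flip)
open import Function.Bundles using (_⤖_; Bijection)

open ≡-Reasoning

module _ {m : ℕ} .{{_ : NonZero m}} where

  %-cong-+ : ∀ {a a' b b'} → a % m ≡ a' % m → b % m ≡ b' % m → (a + b) % m ≡ (a' + b') % m
  %-cong-+ {a} {a'} {b} {b'} ea eb = begin
    (a + b) % m              ≡⟨ %-distribˡ-+ a b m ⟩
    (a % m + b % m) % m      ≡⟨ cong₂ (λ x y → (x + y) % m) ea eb ⟩
    (a' % m + b' % m) % m    ≡⟨ %-distribˡ-+ a' b' m ⟨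
    (a' + b') % m            ∎

  -- Cancelling a successor modulo m: add m - 1 to both sides.
  %-cancel-suc : ∀ {u v} → suc u % m ≡ suc v % m → u % m ≡ v % m
  %-cancel-suc {u} {v} e = begin
    u % m                 ≡⟨ [m+n]%n≡m%n u m ⟨
    (u + m) % m           ≡⟨ cong (_% m) (shift u) ⟩
    (suc u + pred m) % m  ≡⟨ %-cong-+ e refl ⟩
    (suc v + pred m) % m  ≡⟨ cong (_% m) (shift v) ⟨
    (v + m) % m           ≡⟨ [m+n]%n≡m%n v m ⟩
    v % m                 ∎
    where
    shift : ∀ x → x + m ≡ suc x + pred m
    shift x = trans (cong (x +_) (sym (suc-pred m))) (+-suc x (pred m))

  %-cancelˡ-+ : ∀ d {x y} → (d + x) % m ≡ (d + y) % m → x % m ≡ y % m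
  %-cancelˡ-+ zero    e = e
  %-cancelˡ-+ (suc d) e = %-cancelˡ-+ d (%-cancel-suc e)

  toℕ-mod : ∀ a → toℕ (a mod m) ≡ a % m
  toℕ-mod a = toℕ-fromℕ< (m%n<n a m)

  toℕ≡%⇒≡mod : ∀ {y : Fin m} {a} → toℕ y ≡ a % m → y ≡ a mod m
  toℕ≡%⇒≡mod {y} {a} e = toℕ-injective (trans e (sym (toℕ-mod a)))

  %-≡⇒mod-≡ : ∀ {a b} → a % m ≡ b % m → a mod m ≡ b mod m
  %-≡⇒mod-≡ {a} e = toℕ≡%⇒≡mod (trans (toℕ-mod a) e)

  mod-≡⇒%-≡ : ∀ {a b} → a mod m ≡ b mod m → a % m ≡ b % m
  mod-≡⇒%-≡ {a} {b} e = trans (sym (toℕ-mod a)) (trans (cong toℕ e) (toℕ-mod b))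

  mod-periodic : ∀ a → (m + a) mod m ≡ a mod m
  mod-periodic a = %-≡⇒mod-≡ (%-remove-+ˡ a ∣-refl)

  suc-toℕ-mod : ∀ a → suc (toℕ (a mod m)) % m ≡ suc a % m
  suc-toℕ-mod a = begin
    suc (toℕ (a mod m)) % m  ≡⟨ cong (λ x → suc x % m) (toℕ-mod a) ⟩
    (1 + a % m) % m          ≡⟨ %-cong-+ {1} refl (m%n%n≡m%n a m) ⟩
    suc a % m                ∎

⌊⌋-true : ∀ {A : Set} (d : Dec A) → A → ⌊ d ⌋ ≡ true
⌊⌋-true d a = trans (isYes≗does d) (dec-true d a)

⌊⌋-false : ∀ {A : Set} (d : Dec A) → ¬ A → ⌊ d ⌋ ≡ false
⌊⌋-false d ¬a = trans (isYes≗does d) (dec-false d ¬a)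

module _ {m : ℕ} .{{_ : NonZero m}} where

  cycleAdj-forward : ∀ i j → toℕ j ≡ suc (toℕ i) % m → cycleAdj m i j ≡ true
  cycleAdj-forward i j e = cong (_∨ ⌊ toℕ i ≟ suc (toℕ j) % m ⌋) (⌊⌋-true (toℕ j ≟ suc (toℕ i) % m) e)

  cycleAdj-backward : ∀ i j → toℕ i ≡ suc (toℕ j) % m → cycleAdj m i j ≡ true
  cycleAdj-backward i j e =
    trans (cong (⌊ toℕ j ≟ suc (toℕ i) % m ⌋ ∨_) (⌊⌋-true (toℕ i ≟ suc (toℕ j) % m) e)) (∨-zeroʳ _)

  cycleAdj-neither : ∀ i j → toℕ j ≢ suc (toℕ i) % m → toℕ i ≢ suc (toℕ j) % m → cycleAdj m i j ≡ false
  cycleAdj-neither i j ¬forward ¬backward =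
    cong₂ _∨_ (⌊⌋-false (toℕ j ≟ suc (toℕ i) % m) ¬forward) (⌊⌋-false (toℕ i ≟ suc (toℕ j) % m) ¬backward)

  adj-prev : ∀ a → cycleAdj m (suc a mod m) (a mod m) ≡ true
  adj-prev a = cycleAdj-backward _ _ (trans (toℕ-mod (suc a)) (sym (suc-toℕ-mod a)))

  adj-next : ∀ a → cycleAdj m (suc a mod m) (suc (suc a) mod m) ≡ true
  adj-next a = cycleAdj-forward _ _ (trans (toℕ-mod (2 + a)) (sym (suc-toℕ-mod (suc a))))

  adj-other : ∀ a (y : Fin m) → y ≢ a mod m → y ≢ suc (suc a) mod m →
              cycleAdj m (suc a mod m) y ≡ false
  adj-other a y y≢prev y≢next = cycleAdj-neither _ _ not-next not-prev
    where
    not-next : toℕ y ≢ suc (toℕ (suc a mod m)) % m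
    not-next e = y≢next (toℕ≡%⇒≡mod (trans e (suc-toℕ-mod (suc a))))
    not-prev : toℕ (suc a mod m) ≢ suc (toℕ y) % m
    not-prev e = y≢prev (toℕ≡%⇒≡mod (begin
      toℕ y      ≡⟨ m<n⇒m%n≡m (toℕ<n y) ⟨
      toℕ y % m  ≡⟨ %-cancel-suc (trans (sym e) (toℕ-mod (suc a))) ⟩
      a % m      ∎))

-- In a cycle of length at least 3 the two neighbours of a vertex are distinct:
-- cancelling a from a ≡ a + 2 (mod m) leaves 0 ≡ 2 (mod m), false for m > 2.
neighbours-distinct : ∀ {m} .{{_ : NonZero m}} → 3 ≤ m → ∀ a → a mod m ≢ suc (suc a) mod m
neighbours-distinct {suc zero} (s≤s ()) a
neighbours-distinct {suc (suc zero)} (s≤s (s≤s ())) a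
neighbours-distinct {m@(suc (suc (suc _)))} _ a e with %-cancelˡ-+ a (begin
    (a + 0) % m  ≡⟨ cong (_% m) (+-identityʳ a) ⟩
    a % m        ≡⟨ mod-≡⇒%-≡ {a = a} {b = 2 + a} e ⟩
    (2 + a) % m  ≡⟨ cong (_% m) (+-comm 2 a) ⟩
    (a + 2) % m  ∎)
... | ()

sum-zero : ∀ {m} (h : Fin m → ℕ) → (∀ y → h y ≡ 0) → sum (tabulate h) ≡ 0
sum-zero {zero}  h vanish = refl
sum-zero {suc m} h vanish = cong₂ _+_ (vanish fzero) (sum-zero (h ∘ fsuc) (vanish ∘ fsuc))

sum-point : ∀ {m} (h : Fin m → ℕ) p → (∀ y → y ≢ p → h y ≡ 0) → sum (tabulate h) ≡ h p
sum-point h fzero vanish =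
  trans (cong (h fzero +_) (sum-zero (h ∘ fsuc) (λ y → vanish (fsuc y) (λ ())))) (+-identityʳ _)
sum-point h (fsuc p) vanish =
  cong₂ _+_ (vanish fzero (λ ())) (sum-point (h ∘ fsuc) p (λ y y≢p → vanish (fsuc y) (y≢p ∘ suc-injective)))

sum-pair : ∀ {m} (h : Fin m → ℕ) p q → p ≢ q → (∀ y → y ≢ p → y ≢ q → h y ≡ 0) →
           sum (tabulate h) ≡ h p + h q
sum-pair h fzero fzero p≢q vanish = ⊥-elim (p≢q refl)
sum-pair h fzero (fsuc q) p≢q vanish =
  cong (h fzero +_) (sum-point (h ∘ fsuc) q (λ y y≢q → vanish (fsuc y) (λ ()) (y≢q ∘ suc-injective)))
sum-pair h (fsuc p) fzero p≢q vanish =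
  trans (cong (h fzero +_) (sum-point (h ∘ fsuc) p (λ y y≢p → vanish (fsuc y) (y≢p ∘ suc-injective) (λ ()))))
        (+-comm (h fzero) _)
sum-pair h (fsuc p) (fsuc q) p≢q vanish =
  cong₂ _+_ (vanish fzero (λ ()) (λ ()))
            (sum-pair (h ∘ fsuc) p q (p≢q ∘ cong fsuc)
                      (λ y y≢p y≢q → vanish (fsuc y) (y≢p ∘ suc-injective) (y≢q ∘ suc-injective)))

sum-pairs : ∀ {A B : Set} (F : A × B → ℕ) (xs : List A) (ys : List B) →
  sum (map F (concatMap (λ x → map (λ y → (x , y)) ys) xs)) ≡ sum (map (λ x → sum (map (λ y → F (x , y)) ys)) xs)
sum-pairs F []       ys = refl
sum-pairs {A} {B} F (x ∷ xs) ys = begin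
    sum (map F (row x ++ concatMap row xs))            ≡⟨ cong sum (map-++ F (row x) _) ⟩
    sum (map F (row x) ++ map F (concatMap row xs))    ≡⟨ sum-++ (map F (row x)) _ ⟩
    sum (map F (row x)) + sum (map F (concatMap row xs))
      ≡⟨ cong₂ _+_ (cong sum (sym (map-∘ ys))) (sum-pairs F xs ys) ⟩
    sum (map (λ y → F (x , y)) ys) + sum (map (λ x → sum (map (λ y → F (x , y)) ys)) xs) ∎
  where
  row : A → List (A × B)
  row x = map (λ y → (x , y)) ys

sum-if-∧ : ∀ {A : Set} a (b : A → Bool) (h : A → ℕ) (ys : List A) →
  sum (map (λ y → if a ∧ b y then h y else 0) ys) ≡ (if a then sum (map (λ y → if b y then h y else 0) ys) else 0)
sum-if-∧ true  b h ys       = refl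
sum-if-∧ false b h []       = refl
sum-if-∧ false b h (_ ∷ ys) = sum-if-∧ false b h ys

cycle-sum : ∀ {m} .{{_ : NonZero m}} → 3 ≤ m → (g : Fin m → ℕ) (a : ℕ) →
  sum (map (λ y → if cycleAdj m (suc a mod m) y then g y else 0) (allFin m)) ≡ g (a mod m) + g (suc (suc a) mod m)
cycle-sum {m} 3≤m g a = begin
    sum (map h (allFin m))                      ≡⟨ cong sum (map-tabulate id h) ⟩
    sum (tabulate h)                            ≡⟨ sum-pair h _ _ (neighbours-distinct 3≤m a) vanish ⟩
    h (a mod m) + h (suc (suc a) mod m)         ≡⟨ cong₂ _+_ (cong (select (a mod m)) (adj-prev a))
                                                             (cong (select (suc (suc a) mod m)) (adj-next a)) ⟩
    g (a mod m) + g (suc (suc a) mod m)         ∎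
  where
  select : Fin m → Bool → ℕ
  select y b = if b then g y else 0
  h : Fin m → ℕ
  h y = select y (cycleAdj m (suc a mod m) y)
  vanish : ∀ y → y ≢ a mod m → y ≢ suc (suc a) mod m → h y ≡ 0
  vanish y y≢prev y≢next = cong (select y) (adj-other a y y≢prev y≢next)

-- The sum of F over the four diagonal neighbours of (a+1, b+1).
square : (ℕ → ℕ → ℕ) → ℕ → ℕ → ℕ
square F a b = (F a b + F a (2 + b)) + (F (2 + a) b + F (2 + a) (2 + b))

square-flip : ∀ F a b → square (flip F) a b ≡ square F b a
square-flip F a b = interchange (F b a) (F (2 + b) a) (F b (2 + a)) (F (2 + b) (2 + a))

nbhdSum-square : ∀ {m n} .{{_ : NonZero m}} .{{_ : NonZero n}} → 3 ≤ m → 3 ≤ n →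
  (f : Fin m × Fin n → ℕ) (a b : ℕ) →
  nbhdSum m n f (suc a mod m , suc b mod n) ≡ square (λ a b → f (a mod m , b mod n)) a b
nbhdSum-square {m} {n} 3≤m 3≤n f a b = begin
    nbhdSum m n f (i , j)
      ≡⟨ sum-pairs _ (allFin m) (allFin n) ⟩
    sum (map (λ x → sum (map (λ y → if cycleAdj m i x ∧ cycleAdj n j y then f (x , y) else 0) (allFin n))) (allFin m))
      ≡⟨ cong sum (map-cong (λ x → sum-if-∧ (cycleAdj m i x) (cycleAdj n j) (λ y → f (x , y)) (allFin n)) (allFin m)) ⟩
    sum (map (λ x → if cycleAdj m i x then column x else 0) (allFin m))
      ≡⟨ cycle-sum 3≤m column a ⟩
    column (a mod m) + column (suc (suc a) mod m)
      ≡⟨ cong₂ _+_ (cycle-sum 3≤n (λ y → f (a mod m , y)) b) (cycle-sum 3≤n (λ y → f (suc (suc a) mod m , y)) b) ⟩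
    square (λ a b → f (a mod m , b mod n)) a b ∎
  where
  i : Fin m
  i = suc a mod m
  j : Fin n
  j = suc b mod n
  column : Fin m → ℕ
  column x = sum (map (λ y → if cycleAdj n j y then f (x , y) else 0) (allFin n))

period-four : (G : ℕ → ℕ) (k : ℕ) → (∀ a → G a + G (2 + a) ≡ k) → ∀ a → G (4 + a) ≡ G a
period-four G k alternating a = +-cancelˡ-≡ (G (2 + a)) _ _ (begin
    G (2 + a) + G (4 + a)  ≡⟨ alternating (2 + a) ⟩
    k                      ≡⟨ alternating a ⟨
    G a + G (2 + a)        ≡⟨ +-comm (G a) _ ⟩
    G (2 + a) + G a        ∎)

period-multiple : (G : ℕ → ℕ) (p : ℕ) → (∀ a → G (p + a) ≡ G a) → ∀ s a → G (s * p + a) ≡ G a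
period-multiple G p periodic zero    a = refl
period-multiple G p periodic (suc s) a =
  trans (cong G (+-assoc p (s * p) a)) (trans (periodic _) (period-multiple G p periodic s a))

two-mod-four : ∀ m → m % 4 ≢ 0 → ∃₂ λ s c → s * 4 + 2 ≡ c * m
two-mod-four m m%4≢0 with residue (m % 4) (m / 4) m%4≢0 (m%n<n m 4)
  where
  residue : ∀ r q → r ≢ 0 → r < 4 → ∃₂ λ s c → s * 4 + 2 ≡ c * (r + q * 4)
  residue 0 q r≢0 _ = ⊥-elim (r≢0 refl)
  residue 1 q _ _ = q * 2 , 2 , one q
    where one : ∀ q → q * 2 * 4 + 2 ≡ 2 * (1 + q * 4)
          one = solve-∀
  residue 2 q _ _ = q , 1 , two q
    where two : ∀ q → q * 4 + 2 ≡ 1 * (2 + q * 4)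
          two = solve-∀
  residue 3 q _ _ = q * 2 + 1 , 2 , three q
    where three : ∀ q → (q * 2 + 1) * 4 + 2 ≡ 2 * (3 + q * 4)
          three = solve-∀
  residue (suc (suc (suc (suc _)))) q _ (s≤s (s≤s (s≤s (s≤s ()))))
... | s , c , e = s , c , trans e (cong (c *_) (sym (m≡m%n+[m/n]*n m 4)))

-- Key step: if G has period m with 4 ∤ m, and G a + G (a+2) is constant k,
-- then G has period 2, so 2 · G a = k everywhere.
doubled-constant : ∀ m (G : ℕ → ℕ) k → m % 4 ≢ 0 → (∀ a → G (m + a) ≡ G a) →
                   (∀ a → G a + G (2 + a) ≡ k) → ∀ a → G a + G a ≡ k
doubled-constant m G k m%4≢0 periodic alternating a with two-mod-four m m%4≢0
... | s , c , 4s+2≡cm = trans (cong (G a +_) (sym period-two)) (alternating a)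
  where
  period-two : G (2 + a) ≡ G a
  period-two = begin
    G (2 + a)            ≡⟨ period-multiple G 4 (period-four G k alternating) s (2 + a) ⟨
    G (s * 4 + (2 + a))  ≡⟨ cong G (+-assoc (s * 4) 2 a) ⟨
    G (s * 4 + 2 + a)    ≡⟨ cong (λ x → G (x + a)) 4s+2≡cm ⟩
    G (c * m + a)        ≡⟨ period-multiple G m periodic c a ⟩
    G a                  ∎

double-injective : ∀ x y → x + x ≡ y + y → x ≡ y
double-injective x y e = *-cancelˡ-≡ x y 2 (begin
  x + (x + 0)  ≡⟨ cong (x +_) (+-identityʳ x) ⟩
  x + x        ≡⟨ e ⟩
  y + y        ≡⟨ cong (y +_) (+-identityʳ y) ⟨
  y + (y + 0)  ∎)

square-collision : ∀ m (F : ℕ → ℕ → ℕ) k → m % 4 ≢ 0 → (∀ a b → F (m + a) b ≡ F a b) →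
                   (∀ a b → square F a b ≡ k) → F 0 0 ≡ F 0 4
square-collision m F k m%4≢0 periodic magic =
  +-cancelʳ-≡ (F 0 2) (F 0 0) (F 0 4) (trans H₀₀≡H₀₂ (+-comm (F 0 2) (F 0 4)))
  where
  H : ℕ → ℕ → ℕ
  H a b = F a b + F a (2 + b)
  doubled : ∀ b → H 0 b + H 0 b ≡ k
  doubled b = doubled-constant m (λ a → H a b) k m%4≢0
                (λ a → cong₂ _+_ (periodic a b) (periodic a (2 + b))) (λ a → magic a b) 0
  H₀₀≡H₀₂ : H 0 0 ≡ H 0 2
  H₀₀≡H₀₂ = double-injective _ _ (trans (doubled 0) (sym (doubled 2)))

zero≢four-mod : ∀ {n} .{{_ : NonZero n}} → 3 ≤ n → n ≢ 4 → 0 mod n ≢ 4 mod n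
zero≢four-mod {suc zero}                         (s≤s ())
zero≢four-mod {suc (suc zero)}                   (s≤s (s≤s ()))
zero≢four-mod {suc (suc (suc zero))}             _ _   ()
zero≢four-mod {suc (suc (suc (suc zero)))}       _ n≢4 _ = n≢4 refl
zero≢four-mod {suc (suc (suc (suc (suc _))))}    _ _   ()

module _ {m n : ℕ} .{{_ : NonZero m}} .{{_ : NonZero n}} (ℓ : (Fin m × Fin n) ⤖ Fin (m * n)) where

  label : Fin m × Fin n → ℕ
  label y = suc (toℕ (Bijection.to ℓ y))

  labelAt : ℕ → ℕ → ℕ
  labelAt a b = label (a mod m , b mod n)

  labelAt-injective : ∀ {a b a' b'} → labelAt a b ≡ labelAt a' b' → (a mod m , b mod n) ≡ (a' mod m , b' mod n)
  labelAt-injective e = Bijection.injective ℓ (toℕ-injective (suc-injectiveℕ e))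

  labelAt-periodicˡ : ∀ a b → labelAt (m + a) b ≡ labelAt a b
  labelAt-periodicˡ a b = cong (λ x → label (x , b mod n)) (mod-periodic a)

  labelAt-periodicʳ : ∀ a b → labelAt a (n + b) ≡ labelAt a b
  labelAt-periodicʳ a b = cong (λ y → label (a mod m , y)) (mod-periodic b)

  magic-squares : 3 ≤ m → 3 ≤ n → ∀ {k} → (∀ x → nbhdSum m n label x ≡ k) → ∀ a b → square labelAt a b ≡ k
  magic-squares 3≤m 3≤n magic a b = trans (sym (nbhdSum-square 3≤m 3≤n label a b)) (magic _)

theorem3p1 : (m n : ℕ) .{{_ : NonZero m}} .{{_ : NonZero n}} → 3 ≤ m → 3 ≤ n →
    (((m % 4 ≢ 0) × (n ≢ 4)) ⊎ ((n % 4 ≢ 0) × (m ≢ 4))) →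
    ¬ DistanceMagicCmCn m n
theorem3p1 m n 3≤m 3≤n (inj₁ (m%4≢0 , n≢4)) (ℓ , k , _ , magic) =
  zero≢four-mod 3≤n n≢4 (cong proj₂ (labelAt-injective ℓ
    (square-collision m (labelAt ℓ) k m%4≢0 (labelAt-periodicˡ ℓ) (magic-squares ℓ 3≤m 3≤n magic))))
theorem3p1 m n 3≤m 3≤n (inj₂ (n%4≢0 , m≢4)) (ℓ , k , _ , magic) =
  zero≢four-mod 3≤m m≢4 (cong proj₁ (labelAt-injective ℓ
    (square-collision n (flip (labelAt ℓ)) k n%4≢0 (flip (labelAt-periodicʳ ℓ)) squaresᵀ)))
  where
  squaresᵀ : ∀ a b → square (flip (labelAt ℓ)) a b ≡ k
  squaresᵀ a b = trans (square-flip (labelAt ℓ) a b) (magic-squares ℓ 3≤m 3≤n magic b a)
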